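{- Let $m\in\mathbb{N}$ and let $A$ be a finite sequence of positive integers. If $A$ is an $m$-palindrome, then the concatenation $A^2=AA$ is an $m$-palindrome.
   Context: For a finite sequence $X=(x_0,\dots,x_n)$ of positive integers, $[X]$ denotes the value of the finite continued fraction $[x_0,\dots,x_n]$ and $\widetilde X=(x_n,\dots,x_0)$ its reversal. $X$ is an $m$-palindrome if $[X]=m[\widetilde X]$. -}

module Defs where

open import Data.Nat.Base as ℕ using (ℕ; NonZero)
open import Data.Product.Base using (Σ; _,_; proj₁)
open import Data.List.Base using (List; []; _∷_)
open import Data.List.NonEmpty.Base using (List⁺; _∷_; reverse; _⁺++⁺_)
open import Data.Integer.Base using (+_)
open import Data.Nat.Coprimality using (1-coprimeTo; sym)
open import Data.Rational.Base using (ℚ; mkℚ; _+_; _*_; 1/_; Positive; _/_)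
open import Data.Rational.Properties using (pos+pos⇒pos; pos⇒nonZero; 1/pos⇒pos)
open import Relation.Binary.PropositionalEquality using (_≡_)

ℕ⁺ : Set
ℕ⁺ = Σ ℕ NonZero

ℕtoℚ : ℕ → ℚ
ℕtoℚ n = mkℚ (+ n) 0 (sym (1-coprimeTo n))

toℚ : ℕ⁺ → ℚ
toℚ (n , nz) = ℕtoℚ n

-- finite sequences (x₀,…,xₙ) of positive integers (n ≥ 0, so nonempty)
Seq : Set
Seq = List⁺ ℕ⁺

toℚ-pos : (x : ℕ⁺) → Positive (toℚ x)
toℚ-pos (ℕ.suc n , _) = _

-- Value of [x₀, x₁, …, xₙ], together with its positivity:
--   [x₀] = x₀,   [x₀, x₁, …, xₙ] = x₀ + 1 / [x₁, …, xₙ].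
cfPos : ℕ⁺ → List ℕ⁺ → Σ ℚ Positive
cfPos x [] = toℚ x , toℚ-pos x
cfPos x (y ∷ ys) with cfPos y ys
... | (v , pv) =
  let instance _ = pv
               _ = toℚ-pos x
               _ = pos⇒nonZero v
               _ = 1/pos⇒pos v
  in toℚ x + 1/ v , pos+pos⇒pos (toℚ x) (1/ v)

⟦_⟧ : Seq → ℚ
⟦ x ∷ xs ⟧ = proj₁ (cfPos x xs)

IsPalindrome : ℕ → Seq → Set
IsPalindrome m X = ⟦ X ⟧ ≡ ℕtoℚ m * ⟦ reverse X ⟧

-- Multiplying out [x₀, …, xₙ] gives the 2×2 matrix P = M x₀ ⋯ M xₙ with M x = (x 1; 1 0),
-- and [X] = a / c for its first column (a, c).  Each M x is symmetric, so the matrix of the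
-- reversal is the transpose Pᵀ and [X̃] = a / b; hence X is an m-palindrome iff b = m c.
-- The matrix of AA is P², whose off-diagonal entries are b (a + d) and c (a + d), so
-- b = m c passes from P to P².
module Submission where

open import Defs
open import Data.Nat.Base using (ℕ)
open import Data.List.NonEmpty.Base using (_⁺++⁺_)

open import Data.Nat.Base as ℕ using (suc; _<_; z<s; >-nonZero)
import Data.Nat.Properties as ℕ
open import Data.Nat.Tactic.RingSolver using (solve-∀)
open import Data.Product.Base using (_,_; proj₁)
open import Data.List.Base as List using (List; []; _∷_; _++_)
import Data.List.Properties as List
open import Data.List.NonEmpty.Base as List⁺ using (toList)
import Data.List.NonEmpty.Properties as List⁺
import Data.Vec.Base as Vec
import Data.Vec.Properties as Vec
open import Data.Integer.Base as ℤ using (+_)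
import Data.Integer.Properties as ℤ
open import Data.Rational.Base using (ℚ; _+_; _*_; 1/_; ↥_; NonZero)
open import Data.Rational.Properties
  using (toℚᵘ-injective; toℚᵘ-homo-+; toℚᵘ-homo-*; pos⇒nonZero;
         *-comm; *-assoc; *-identityʳ; *-inverseʳ; *-distribʳ-+)
open import Data.Rational.Solver using (module +-*-Solver)
import Data.Rational.Unnormalised.Base as ℚᵘ
import Data.Rational.Unnormalised.Properties as ℚᵘ
open import Function.Bundles using (_⇔_; mk⇔; Equivalence)
open import Relation.Binary.PropositionalEquality

ℕtoℚ-+ : ∀ m n → ℕtoℚ (m ℕ.+ n) ≡ ℕtoℚ m + ℕtoℚ n
ℕtoℚ-+ m n = toℚᵘ-injective (ℚᵘ.≃-trans (ℚᵘ.*≡* numerators) (ℚᵘ.≃-sym (toℚᵘ-homo-+ (ℕtoℚ m) (ℕtoℚ n))))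
  where
  numerators : + (m ℕ.+ n) ℤ.* + 1 ≡ (+ m ℤ.* + 1 ℤ.+ + n ℤ.* + 1) ℤ.* + 1
  numerators = cong (ℤ._* + 1)
    (trans (ℤ.pos-+ m n) (sym (cong₂ ℤ._+_ (ℤ.*-identityʳ (+ m)) (ℤ.*-identityʳ (+ n)))))

ℕtoℚ-* : ∀ m n → ℕtoℚ (m ℕ.* n) ≡ ℕtoℚ m * ℕtoℚ n
ℕtoℚ-* m n = toℚᵘ-injective (ℚᵘ.≃-trans (ℚᵘ.*≡* numerators) (ℚᵘ.≃-sym (toℚᵘ-homo-* (ℕtoℚ m) (ℕtoℚ n))))
  where
  numerators : + (m ℕ.* n) ℤ.* + 1 ≡ (+ m ℤ.* + n) ℤ.* + 1
  numerators = cong (ℤ._* + 1) (ℤ.pos-* m n)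

ℕtoℚ-injective : ∀ {m n} → ℕtoℚ m ≡ ℕtoℚ n → m ≡ n
ℕtoℚ-injective eq = ℤ.+-injective (cong ↥_ eq)

[p*q]*1/q≡p : ∀ p q .{{_ : NonZero q}} → (p * q) * 1/ q ≡ p
[p*q]*1/q≡p p q = trans (*-assoc p q (1/ q)) (trans (cong (p *_) (*-inverseʳ q)) (*-identityʳ p))

1/p*[p*q]≡q : ∀ p q .{{_ : NonZero p}} → 1/ p * (p * q) ≡ q
1/p*[p*q]≡q p q = trans (*-comm (1/ p) (p * q)) (trans (cong (_* 1/ p) (*-comm p q)) ([p*q]*1/q≡p q p))

*-cancelʳ-ℕtoℚ : ∀ p q {n} → 0 < n → p * ℕtoℚ n ≡ q * ℕtoℚ n → p ≡ q
*-cancelʳ-ℕtoℚ p q {suc k} _ eq =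
  trans (sym ([p*q]*1/q≡p p (ℕtoℚ (suc k))))
        (trans (cong (_* 1/ ℕtoℚ (suc k)) eq) ([p*q]*1/q≡p q (ℕtoℚ (suc k))))

record Mat : Set where
  constructor ⟨_,_,_,_⟩
  field a b c d : ℕ
open Mat

infixl 7 _·_
_·_ : Mat → Mat → Mat
⟨ a , b , c , d ⟩ · ⟨ e , f , g , h ⟩ =
  ⟨ a ℕ.* e ℕ.+ b ℕ.* g , a ℕ.* f ℕ.+ b ℕ.* h , c ℕ.* e ℕ.+ d ℕ.* g , c ℕ.* f ℕ.+ d ℕ.* h ⟩

I : Mat
I = ⟨ 1 , 0 , 0 , 1 ⟩

infix 8 _ᵀ
_ᵀ : Mat → Mat
⟨ a , b , c , d ⟩ ᵀ = ⟨ a , c , b , d ⟩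

Mat-≡ : ∀ {a b c d a′ b′ c′ d′} → a ≡ a′ → b ≡ b′ → c ≡ c′ → d ≡ d′ →
        ⟨ a , b , c , d ⟩ ≡ ⟨ a′ , b′ , c′ , d′ ⟩
Mat-≡ refl refl refl refl = refl

·-assoc : ∀ P Q R → (P · Q) · R ≡ P · (Q · R)
·-assoc ⟨ a , b , c , d ⟩ ⟨ e , f , g , h ⟩ ⟨ i , j , k , l ⟩ =
  Mat-≡ (entry a b e f g h i k) (entry a b e f g h j l) (entry c d e f g h i k) (entry c d e f g h j l)
  where
  entry : ∀ x y e f g h z w → (x ℕ.* e ℕ.+ y ℕ.* g) ℕ.* z ℕ.+ (x ℕ.* f ℕ.+ y ℕ.* h) ℕ.* w
                            ≡ x ℕ.* (e ℕ.* z ℕ.+ f ℕ.* w) ℕ.+ y ℕ.* (g ℕ.* z ℕ.+ h ℕ.* w)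
  entry = solve-∀

·-identityˡ : ∀ P → I · P ≡ P
·-identityˡ ⟨ a , b , c , d ⟩ = Mat-≡ (entry a c) (entry b d) (entry′ a c) (entry′ b d)
  where
  entry : ∀ x y → 1 ℕ.* x ℕ.+ 0 ℕ.* y ≡ x
  entry = solve-∀
  entry′ : ∀ x y → 0 ℕ.* x ℕ.+ 1 ℕ.* y ≡ y
  entry′ = solve-∀

·-identityʳ : ∀ P → P · I ≡ P
·-identityʳ ⟨ a , b , c , d ⟩ = Mat-≡ (entry a b) (entry′ a b) (entry c d) (entry′ c d)
  where
  entry : ∀ x y → x ℕ.* 1 ℕ.+ y ℕ.* 0 ≡ x
  entry = solve-∀
  entry′ : ∀ x y → x ℕ.* 0 ℕ.+ y ℕ.* 1 ≡ y
  entry′ = solve-∀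

ᵀ-· : ∀ P Q → (P · Q) ᵀ ≡ Q ᵀ · P ᵀ
ᵀ-· ⟨ a , b , c , d ⟩ ⟨ e , f , g , h ⟩ = Mat-≡ (entry a b e g) (entry c d e g) (entry a b f h) (entry c d f h)
  where
  entry : ∀ x y z w → x ℕ.* z ℕ.+ y ℕ.* w ≡ z ℕ.* x ℕ.+ w ℕ.* y
  entry = solve-∀

M : ℕ → Mat
M x = ⟨ x , 1 , 1 , 0 ⟩

a-M· : ∀ x P → a (M x · P) ≡ x ℕ.* a P ℕ.+ c P
a-M· x P = cong (x ℕ.* a P ℕ.+_) (ℕ.*-identityˡ (c P))

c-M· : ∀ x P → c (M x · P) ≡ a P
c-M· x P = trans (ℕ.+-identityʳ (1 ℕ.* a P)) (ℕ.*-identityˡ (a P))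

cfMatrix : List ℕ⁺ → Mat
cfMatrix []       = I
cfMatrix (x ∷ xs) = M (proj₁ x) · cfMatrix xs

cfMatrix-++ : ∀ xs ys → cfMatrix (xs ++ ys) ≡ cfMatrix xs · cfMatrix ys
cfMatrix-++ []       ys = sym (·-identityˡ (cfMatrix ys))
cfMatrix-++ (x ∷ xs) ys =
  trans (cong (M (proj₁ x) ·_) (cfMatrix-++ xs ys)) (sym (·-assoc (M (proj₁ x)) (cfMatrix xs) (cfMatrix ys)))

cfMatrix-reverse : ∀ xs → cfMatrix (List.reverse xs) ≡ cfMatrix xs ᵀ
cfMatrix-reverse []       = refl
cfMatrix-reverse (x ∷ xs) = begin
  cfMatrix (List.reverse (x ∷ xs))              ≡⟨ cong cfMatrix (List.unfold-reverse x xs) ⟩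
  cfMatrix (List.reverse xs ++ x ∷ [])          ≡⟨ cfMatrix-++ (List.reverse xs) (x ∷ []) ⟩
  cfMatrix (List.reverse xs) · (M (proj₁ x) · I) ≡⟨ cong₂ _·_ (cfMatrix-reverse xs) (·-identityʳ (M (proj₁ x))) ⟩
  cfMatrix xs ᵀ · M (proj₁ x) ᵀ                 ≡⟨ sym (ᵀ-· (M (proj₁ x)) (cfMatrix xs)) ⟩
  cfMatrix (x ∷ xs) ᵀ                           ∎
  where open ≡-Reasoning

a-cfMatrix-pos : ∀ x xs → 0 < a (cfMatrix (x ∷ xs))
a-cfMatrix-pos (suc n , _) []       = z<s
a-cfMatrix-pos (suc n , _) (y ∷ ys) =
  ℕ.<-≤-trans (a-cfMatrix-pos y ys) (ℕ.≤-trans (ℕ.m≤m+n A (n ℕ.* A)) (ℕ.m≤m+n (suc n ℕ.* A) _))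
  where A = a (cfMatrix (y ∷ ys))

c-cfMatrix-pos : ∀ x xs → 0 < c (cfMatrix (x ∷ xs))
c-cfMatrix-pos x []       = z<s
c-cfMatrix-pos x (y ∷ ys) =
  subst (0 <_) (sym (c-M· (proj₁ x) (cfMatrix (y ∷ ys)))) (a-cfMatrix-pos y ys)

cfPos-cfMatrix : ∀ x xs → proj₁ (cfPos x xs) * ℕtoℚ (c (cfMatrix (x ∷ xs))) ≡ ℕtoℚ (a (cfMatrix (x ∷ xs)))
cfPos-cfMatrix (n , _) [] =
  trans (*-identityʳ (ℕtoℚ n)) (cong (λ P → ℕtoℚ (a P)) (sym (·-identityʳ (M n))))
cfPos-cfMatrix (n , _) (y ∷ ys) with cfPos y ys | cfPos-cfMatrix y ys
... | v , v>0 | v*C≡A = begin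
  (X + 1/ v) * ℕtoℚ (c (M n · P))  ≡⟨ cong (λ t → (X + 1/ v) * ℕtoℚ t) (c-M· n P) ⟩
  (X + 1/ v) * ℕtoℚ A              ≡⟨ *-distribʳ-+ (ℕtoℚ A) X (1/ v) ⟩
  X * ℕtoℚ A + 1/ v * ℕtoℚ A       ≡⟨ cong (λ t → X * ℕtoℚ A + 1/ v * t) (sym v*C≡A) ⟩
  X * ℕtoℚ A + 1/ v * (v * ℕtoℚ C) ≡⟨ cong (λ t → X * ℕtoℚ A + t) (1/p*[p*q]≡q v (ℕtoℚ C)) ⟩
  X * ℕtoℚ A + ℕtoℚ C              ≡⟨ cong (_+ ℕtoℚ C) (sym (ℕtoℚ-* n A)) ⟩
  ℕtoℚ (n ℕ.* A) + ℕtoℚ C          ≡⟨ sym (ℕtoℚ-+ (n ℕ.* A) C) ⟩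
  ℕtoℚ (n ℕ.* A ℕ.+ C)             ≡⟨ cong ℕtoℚ (sym (a-M· n P)) ⟩
  ℕtoℚ (a (M n · P))               ∎
  where
  open ≡-Reasoning
  instance _ = pos⇒nonZero v {{v>0}}
  X = ℕtoℚ n
  P = cfMatrix (y ∷ ys)
  A = a P
  C = c P

seqMatrix : Seq → Mat
seqMatrix X = cfMatrix (toList X)

seqMatrix-⁺++⁺ : ∀ X Y → seqMatrix (X ⁺++⁺ Y) ≡ seqMatrix X · seqMatrix Y
seqMatrix-⁺++⁺ X Y = trans (cong cfMatrix (sym (List⁺.toList-⁺++⁺ X Y))) (cfMatrix-++ (toList X) (toList Y))

toList-fromVec : ∀ {A : Set} {n} (v : Vec.Vec A (suc n)) → toList (List⁺.fromVec v) ≡ Vec.toList v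
toList-fromVec (x Vec.∷ xs) = refl

toList-reverse : ∀ {A : Set} (X : List⁺.List⁺ A) → toList (List⁺.reverse X) ≡ List.reverse (toList X)
toList-reverse (x List⁺.∷ xs) = begin
  toList (List⁺.reverse (x List⁺.∷ xs))              ≡⟨ toList-fromVec (Vec.reverse (x Vec.∷ Vec.fromList xs)) ⟩
  Vec.toList (Vec.reverse (x Vec.∷ Vec.fromList xs)) ≡⟨ Vec.toList-reverse (x Vec.∷ Vec.fromList xs) ⟩
  List.reverse (x ∷ Vec.toList (Vec.fromList xs))    ≡⟨ cong (λ ys → List.reverse (x ∷ ys)) (Vec.toList∘fromList xs) ⟩
  List.reverse (x ∷ xs)                              ∎
  where open ≡-Reasoning

seqMatrix-reverse : ∀ X → seqMatrix (List⁺.reverse X) ≡ seqMatrix X ᵀ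
seqMatrix-reverse X = trans (cong cfMatrix (toList-reverse X)) (cfMatrix-reverse (toList X))

⟦⟧-seqMatrix : ∀ X → ⟦ X ⟧ * ℕtoℚ (c (seqMatrix X)) ≡ ℕtoℚ (a (seqMatrix X))
⟦⟧-seqMatrix (x List⁺.∷ xs) = cfPos-cfMatrix x xs

⟦reverse⟧-seqMatrix : ∀ X → ⟦ List⁺.reverse X ⟧ * ℕtoℚ (b (seqMatrix X)) ≡ ℕtoℚ (a (seqMatrix X))
⟦reverse⟧-seqMatrix X =
  subst (λ P → ⟦ List⁺.reverse X ⟧ * ℕtoℚ (c P) ≡ ℕtoℚ (a P)) (seqMatrix-reverse X) (⟦⟧-seqMatrix (List⁺.reverse X))

isPalindrome⇔ : ∀ m X → IsPalindrome m X ⇔ b (seqMatrix X) ≡ m ℕ.* c (seqMatrix X)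
isPalindrome⇔ m X@(x List⁺.∷ xs) = mk⇔ palindrome⇒ ⇒palindrome
  where
  open ≡-Reasoning
  open +-*-Solver using (solve; _:*_; _:=_)
  P = seqMatrix X
  vX = ⟦ X ⟧
  vR = ⟦ List⁺.reverse X ⟧
  a′ b′ c′ m′ : ℚ
  a′ = ℕtoℚ (a P)
  b′ = ℕtoℚ (b P)
  c′ = ℕtoℚ (c P)
  m′ = ℕtoℚ m

  palindrome⇒ : vX ≡ m′ * vR → b P ≡ m ℕ.* c P
  palindrome⇒ pal = ℕ.*-cancelʳ-≡ (b P) (m ℕ.* c P) (a P) {{>-nonZero (a-cfMatrix-pos x xs)}} (ℕtoℚ-injective (begin
    ℕtoℚ (b P ℕ.* a P)        ≡⟨ ℕtoℚ-* (b P) (a P) ⟩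
    b′ * a′                   ≡⟨ cong (b′ *_) (sym (⟦⟧-seqMatrix X)) ⟩
    b′ * (vX * c′)            ≡⟨ cong (λ t → b′ * (t * c′)) pal ⟩
    b′ * ((m′ * vR) * c′)     ≡⟨ solve 4 (λ b m r c → b :* ((m :* r) :* c) := (m :* c) :* (r :* b)) refl b′ m′ vR c′ ⟩
    (m′ * c′) * (vR * b′)     ≡⟨ cong₂ _*_ (sym (ℕtoℚ-* m (c P))) (⟦reverse⟧-seqMatrix X) ⟩
    ℕtoℚ (m ℕ.* c P) * a′     ≡⟨ sym (ℕtoℚ-* (m ℕ.* c P) (a P)) ⟩
    ℕtoℚ (m ℕ.* c P ℕ.* a P)  ∎))

  ⇒palindrome : b P ≡ m ℕ.* c P → vX ≡ m′ * vR
  ⇒palindrome b≡mc = *-cancelʳ-ℕtoℚ vX (m′ * vR) (c-cfMatrix-pos x xs) (begin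
    vX * c′                   ≡⟨ ⟦⟧-seqMatrix X ⟩
    a′                        ≡⟨ sym (⟦reverse⟧-seqMatrix X) ⟩
    vR * b′                   ≡⟨ cong (λ t → vR * ℕtoℚ t) b≡mc ⟩
    vR * ℕtoℚ (m ℕ.* c P)     ≡⟨ cong (vR *_) (ℕtoℚ-* m (c P)) ⟩
    vR * (m′ * c′)            ≡⟨ solve 3 (λ r m c → r :* (m :* c) := (m :* r) :* c) refl vR m′ c′ ⟩
    (m′ * vR) * c′            ∎)

b≡m*c⇒square : ∀ m P → b P ≡ m ℕ.* c P → b (P · P) ≡ m ℕ.* c (P · P)
b≡m*c⇒square m ⟨ p , q , r , s ⟩ refl = entry m p r s
  where
  entry : ∀ m p r s → p ℕ.* (m ℕ.* r) ℕ.+ (m ℕ.* r) ℕ.* s ≡ m ℕ.* (r ℕ.* p ℕ.+ s ℕ.* r)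
  entry = solve-∀

lemma3p6 : (m : ℕ) (A : Seq) → IsPalindrome m A → IsPalindrome m (A ⁺++⁺ A)
lemma3p6 m A pal = Equivalence.from (isPalindrome⇔ m (A ⁺++⁺ A))
  (subst (λ P → b P ≡ m ℕ.* c P) (sym (seqMatrix-⁺++⁺ A A))
    (b≡m*c⇒square m (seqMatrix A) (Equivalence.to (isPalindrome⇔ m A) pal)))
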